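{- Let $n\ge 2$ and let $S$ be an admissible subset of $\{r,b,g,y,o,s\}$ with $g\in S$. Then there is a bijection $Y_n(S)\to J(T_n(S))$ which is weight-preserving, where the weight of $x\in Y_n(S)$ is $\sum_{i=1}^{n-1}\sum_{j=0}^{n-i}(x_{i,j}-i)$ and the weight of an order ideal $I\in J(T_n(S))$ is $|I|$.
   Context: Let $T_n$ be the set of triples $(c_1,c_2,c_3)$ of nonnegative integers with $c_1+c_2+c_3\le n-2$. To the six colors red $r$, green $g$, yellow $y$, blue $b$, orange $o$, silver $s$ associate the vectors $v_r=(1,0,0)$, $v_g=(0,1,0)$, $v_y=(0,0,1)$, $v_b=(-1,1,0)$, $v_o=(-1,0,1)$, $v_s=(0,1,-1)$. For a set $S$ of colors, $T_n(S)$ is the poset on the set $T_n$ whose order is the reflexive–transitive closure of the relations $p<p+v_x$ for all $x\in S$ and all $p$ with $p,p+v_x\in T_n$. A set $S$ of colors is admissible if: $\{r,b\}\subseteq S\Rightarrow g\in S$; $\{o,s\}\subseteq S\Rightarrow b\in S$; $\{s,y\}\subseteq S\Rightarrow g\in S$; $\{r,o\}\subseteq S\Rightarrow y\in S$. $J(P)$ denotes the set of order ideals (down-closed subsets, including $\emptyset$) of a poset $P$. For admissible $S$ with $g\in S$, $Y_n(S)$ is the set of integer arrays $x=(x_{i,j})$, $1\le i\le n$, $0\le j\le n-i$, with $i\le x_{i,j}\le i+j$ for all $i,j$ and satisfying, for each color in $S$ and whenever all entries involved are defined: orange: $x_{i,j}<x_{i+1,j}$; red: $x_{i,j}\le x_{i-1,j+1}+1$;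 yellow: $x_{i,j}\le x_{i,j+1}$; blue: $x_{i,j}\le x_{i+1,j-1}$; silver: $x_{i,j}\le x_{i,j-1}+1$ (green imposes no further condition). -}

module Defs where

open import Data.Nat using (ℕ; zero; suc; _+_; _∸_; _≤_; _<_)
open import Data.Bool using (Bool; true; false; if_then_else_)
open import Data.Product using (Σ; _×_; _,_; proj₁; proj₂)
open import Data.List using (List; map; upTo)
open import Data.Nat.ListAction using (sum)
open import Relation.Binary.PropositionalEquality using (_≡_; refl; sym; trans)
open import Relation.Binary.Bundles using (Setoid)
open import Relation.Binary.Construct.Closure.ReflexiveTransitive using (Star)
open import Level using (0ℓ)

data Color : Set where
  red green yellow blue orange silver : Color

ColorSet : Set
ColorSet = Color → Bool

_∈S_ : Color → ColorSet → Set
c ∈S S = S c ≡ true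

Admissible : ColorSet → Set
Admissible S =
  (red ∈S S → blue ∈S S → green ∈S S) ×
  (orange ∈S S → silver ∈S S → blue ∈S S) ×
  (silver ∈S S → yellow ∈S S → green ∈S S) ×
  (red ∈S S → orange ∈S S → yellow ∈S S)

Triple : Set
Triple = ℕ × ℕ × ℕ

InT : ℕ → Triple → Set
InT n (a , b , c) = a + b + c ≤ n ∸ 2

-- Move c p q  means  q = p + v_c  (all coordinates nonnegative).
-- v_r=(1,0,0), v_g=(0,1,0), v_y=(0,0,1), v_b=(-1,1,0), v_o=(-1,0,1), v_s=(0,1,-1)
data Move : Color → Triple → Triple → Set where
  mr : ∀ {a b c} → Move red    (a , b , c)     (suc a , b , c)
  mg : ∀ {a b c} → Move green  (a , b , c)     (a , suc b , c)
  my : ∀ {a b c} → Move yellow (a , b , c)     (a , b , suc c)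
  mb : ∀ {a b c} → Move blue   (suc a , b , c) (a , suc b , c)
  mo : ∀ {a b c} → Move orange (suc a , b , c) (a , b , suc c)
  ms : ∀ {a b c} → Move silver (a , b , suc c) (a , suc b , c)

Step : ℕ → ColorSet → Triple → Triple → Set
Step n S p q = Σ Color λ x → x ∈S S × InT n p × InT n q × Move x p q

_≼[_,_]_ : Triple → ℕ → ColorSet → Triple → Set
p ≼[ n , S ] q = Star (Step n S) p q

IsIdeal : ℕ → ColorSet → (Triple → Bool) → Set
IsIdeal n S I =
  (∀ p → I p ≡ true → InT n p) ×
  (∀ p q → p ≼[ n , S ] q → I q ≡ true → I p ≡ true)

Ideal : ℕ → ColorSet → Set
Ideal n S = Σ (Triple → Bool) (IsIdeal n S)

JSetoid : ℕ → ColorSet → Setoid 0ℓ 0ℓ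
JSetoid n S = record
  { Carrier = Ideal n S
  ; _≈_ = λ I J → ∀ p → proj₁ I p ≡ proj₁ J p
  ; isEquivalence = record
    { refl = λ p → refl
    ; sym = λ e p → sym (e p)
    ; trans = λ e f p → trans (e p) (f p) } }

Σ< : ℕ → (ℕ → ℕ) → ℕ
Σ< m f = sum (map f (upTo m))

-- |I| : every element of T_n has coordinates < n, so this counts I exactly.
weightJ : ∀ n S → Ideal n S → ℕ
weightJ n S I =
  Σ< n λ a → Σ< n λ b → Σ< n λ c → if proj₁ I (a , b , c) then 1 else 0

Dom : ℕ → ℕ → ℕ → Set
Dom n i j = 1 ≤ i × i + j ≤ n

-- Arrays are functions ℕ → ℕ → ℕ, only their values on Dom n matter.
Array : Set
Array = ℕ → ℕ → ℕ

IsY : ℕ → ColorSet → Array → Set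
IsY n S x =
  (∀ i j → Dom n i j → i ≤ x i j × x i j ≤ i + j) ×
  (orange ∈S S → ∀ i j → Dom n i j → Dom n (suc i) j → x i j < x (suc i) j) ×
  -- red: x_{i,j} ≤ x_{i-1,j+1} + 1
  (red ∈S S → ∀ i j → Dom n (suc i) j → Dom n i (suc j) → x (suc i) j ≤ x i (suc j) + 1) ×
  (yellow ∈S S → ∀ i j → Dom n i j → Dom n i (suc j) → x i j ≤ x i (suc j)) ×
  -- blue: x_{i,j} ≤ x_{i+1,j-1}
  (blue ∈S S → ∀ i j → Dom n i (suc j) → Dom n (suc i) j → x i (suc j) ≤ x (suc i) j) ×
  -- silver: x_{i,j} ≤ x_{i,j-1} + 1
  (silver ∈S S → ∀ i j → Dom n i (suc j) → Dom n i j → x i (suc j) ≤ x i j + 1)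

Y : ℕ → ColorSet → Set
Y n S = Σ Array (IsY n S)

YSetoid : ℕ → ColorSet → Setoid 0ℓ 0ℓ
YSetoid n S = record
  { Carrier = Y n S
  ; _≈_ = λ x z → ∀ i j → Dom n i j → proj₁ x i j ≡ proj₁ z i j
  ; isEquivalence = record
    { refl = λ i j d → refl
    ; sym = λ e i j d → sym (e i j d)
    ; trans = λ e f i j d → trans (e i j d) (f i j d) } }

weightY : ∀ n S → Y n S → ℕ
weightY n S x =
  Σ< (n ∸ 1) λ i' → Σ< (suc (n ∸ suc i')) λ j → proj₁ x (suc i') j ∸ suc i'

-- Since green ∈ S, an order ideal I of T_n(S) is closed downwards in each green column
-- {(a , b , c) ∣ b < n - 1 - a - c}, so it is an initial segment b < h(a , c) of every column;
-- I is determined by the heights h, and |I| = Σ h. Column (a , c) of T_n is matched with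
-- the cell (a + 1 , n - 1 - a - c) of the array via x = a + 1 + h, and under this matching
-- the covering relations of each other colour in T_n(S) become exactly the array
-- inequality of that colour in Y_n(S).
module Submission where

open import Defs
open import Data.Nat using (ℕ; zero; suc; _+_; _∸_; _⊓_; _≤_; _<_; _<ᵇ_; z≤n; s≤s)
open import Data.Nat.Properties
open import Data.Nat.ListAction using (sum)
open import Data.Bool using (Bool; true; false; if_then_else_)
open import Data.Bool.Properties using (T-≡; ⇔→≡)
open import Data.List using (_∷_; map; applyUpTo)
open import Data.Product using (Σ; ∃-syntax; _×_; _,_; proj₁; proj₂)
open import Data.Sum using (_⊎_; inj₁; inj₂)
open import Function using (_∘_; id)
open import Function.Bundles using (Bijection; Inverse; Equivalence; mk⇔)
open import Function.Properties.Inverse using (Inverse⇒Bijection)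
open import Algebra.Properties.CommutativeSemigroup +-commutativeSemigroup using (interchange)
open import Relation.Nullary using (yes; no)
open import Relation.Binary.PropositionalEquality
open import Relation.Binary.Construct.Closure.ReflexiveTransitive using (ε; _◅_; fold)

private
  variable
    a b c j k m : ℕ
    f g : ℕ → ℕ
    h : ℕ → Bool
    x : Array
    u v : Triple

<ᵇ≡true⇒< : (b <ᵇ k) ≡ true → b < k
<ᵇ≡true⇒< {b} {k} e = <ᵇ⇒< b k (Equivalence.from T-≡ e)

<⇒<ᵇ≡true : b < k → (b <ᵇ k) ≡ true
<⇒<ᵇ≡true b<k = Equivalence.to T-≡ (<⇒<ᵇ b<k)

shifted-<ᵇ : ∀ δ → k ≤ δ + j → (δ + b <ᵇ k) ≡ true → (b <ᵇ j) ≡ true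
shifted-<ᵇ δ k≤δ+j e = <⇒<ᵇ≡true (+-cancelˡ-< δ _ _ (<-≤-trans (<ᵇ≡true⇒< e) k≤δ+j))

shifted-<⇒≤ : ∀ δ k j → (∀ b → δ + b < k → b < j) → k ≤ δ + j
shifted-<⇒≤ zero    zero    j below = z≤n
shifted-<⇒≤ zero    (suc k) j below = below k ≤-refl
shifted-<⇒≤ (suc δ) zero    j below = z≤n
shifted-<⇒≤ (suc δ) (suc k) j below = s≤s (shifted-<⇒≤ δ k j (λ b lt → below b (s≤s lt)))

∸-+-complement : a + j ≤ m → m ∸ (a + (m ∸ (a + j))) ≡ j
∸-+-complement {a} {j} {m} a+j≤m = begin
  m ∸ (a + r)             ≡⟨ cong (_∸ (a + r)) (m∸n+n≡m a+j≤m) ⟨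
  r + (a + j) ∸ (a + r)   ≡⟨ cong (_∸ (a + r)) (+-assoc r a j) ⟨
  r + a + j ∸ (a + r)     ≡⟨ cong (λ t → t + j ∸ (a + r)) (+-comm r a) ⟩
  a + r + j ∸ (a + r)     ≡⟨ m+n∸m≡n (a + r) j ⟩
  j                       ∎
  where
  open ≡-Reasoning
  r = m ∸ (a + j)

∸≤suc∸suc : ∀ m k → m ∸ k ≤ suc (m ∸ suc k)
∸≤suc∸suc zero    zero    = z≤n
∸≤suc∸suc zero    (suc k) = z≤n
∸≤suc∸suc (suc m) zero    = ≤-refl
∸≤suc∸suc (suc m) (suc k) = ∸≤suc∸suc m k

suc∸≤suc∸ : ∀ m k → suc m ∸ k ≤ suc (m ∸ k)
suc∸≤suc∸ m       zero    = ≤-refl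
suc∸≤suc∸ zero    (suc k) = m∸n≤m 1 (suc k)
suc∸≤suc∸ (suc m) (suc k) = suc∸≤suc∸ m k

+<⇒<∸ : b + k < m → b < m ∸ k
+<⇒<∸ {b} = m+n≤o⇒m≤o∸n (suc b)

<∸⇒+< : b < m ∸ k → b + k < m
<∸⇒+< {b} {m} {k} lt = m≤o∸n⇒m+n≤o (suc b) (<⇒≤ (m∸n≢0⇒n<m (λ e → n≮0 (subst (b <_) e lt)))) lt

+-shuffle : ∀ a b c → a + b + c ≡ b + (a + c)
+-shuffle a b c = trans (cong (_+ c) (+-comm a b)) (+-assoc b a c)

≤+1⇒≤suc : j ≤ k + 1 → j ≤ suc k
≤+1⇒≤suc {j} {k} = subst (j ≤_) (+-comm k 1)

leadingTrues : (ℕ → Bool) → ℕ → ℕ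
leadingTrues h zero    = 0
leadingTrues h (suc m) = if h 0 then suc (leadingTrues (h ∘ suc) m) else 0

leadingTrues-≤ : ∀ h m → leadingTrues h m ≤ m
leadingTrues-≤ h zero = z≤n
leadingTrues-≤ h (suc m) with h 0
... | true  = s≤s (leadingTrues-≤ (h ∘ suc) m)
... | false = z≤n

leadingTrues-sound : ∀ h m → b < leadingTrues h m → h b ≡ true
leadingTrues-sound h (suc m) b<run with h 0 in h0
leadingTrues-sound {zero}  h (suc m) _         | true = h0
leadingTrues-sound {suc b} h (suc m) (s≤s b<run) | true = leadingTrues-sound (h ∘ suc) m b<run

DownClosed : (ℕ → Bool) → Set
DownClosed h = ∀ b → h (suc b) ≡ true → h b ≡ true

downClosed-zero : DownClosed h → h b ≡ true → h 0 ≡ true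
downClosed-zero {b = zero}  down hb = hb
downClosed-zero {b = suc b} down hb = downClosed-zero down (down b hb)

leadingTrues-complete : ∀ h m → DownClosed h → b < m → h b ≡ true → b < leadingTrues h m
leadingTrues-complete h (suc m) down b<m hb with h 0 in h0
leadingTrues-complete {zero}  h (suc m) down _         hb | true = s≤s z≤n
leadingTrues-complete {suc b} h (suc m) down (s≤s b<m) hb | true =
  s≤s (leadingTrues-complete (h ∘ suc) m (down ∘ suc) b<m hb)
... | false with () ← trans (sym h0) (downClosed-zero down hb)

leadingTrues-cong : ∀ {h h′ : ℕ → Bool} m → (∀ b → h b ≡ h′ b) → leadingTrues h m ≡ leadingTrues h′ m
leadingTrues-cong zero    eq = refl
leadingTrues-cong (suc m) eq rewrite eq 0 = cong (λ r → if _ then suc r else 0) (leadingTrues-cong m (eq ∘ suc))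

leadingTrues-<ᵇ : k ≤ m → leadingTrues (_<ᵇ k) m ≡ k
leadingTrues-<ᵇ {zero}  {zero}  _         = refl
leadingTrues-<ᵇ {zero}  {suc m} _         = refl
leadingTrues-<ᵇ {suc k} {suc m} (s≤s k≤m) = cong suc (leadingTrues-<ᵇ k≤m)

∑ : ℕ → (ℕ → ℕ) → ℕ
∑ m f = sum (applyUpTo f m)

map-applyUpTo : ∀ (f g : ℕ → ℕ) m → map f (applyUpTo g m) ≡ applyUpTo (f ∘ g) m
map-applyUpTo f g zero    = refl
map-applyUpTo f g (suc m) = cong (f (g 0) ∷_) (map-applyUpTo f (g ∘ suc) m)

Σ<≡∑ : ∀ m f → Σ< m f ≡ ∑ m f
Σ<≡∑ m f = cong sum (map-applyUpTo f id m)

∑-cong : ∀ m → (∀ k → k < m → f k ≡ g k) → ∑ m f ≡ ∑ m g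
∑-cong zero    eq = refl
∑-cong (suc m) eq = cong₂ _+_ (eq 0 (s≤s z≤n)) (∑-cong m (λ k k<m → eq (suc k) (s≤s k<m)))

Σ<≡∑-cong : ∀ m → (∀ k → k < m → f k ≡ g k) → Σ< m f ≡ ∑ m g
Σ<≡∑-cong {f} m eq = trans (Σ<≡∑ m f) (∑-cong m eq)

∑-zero : ∀ m → (∀ k → k < m → f k ≡ 0) → ∑ m f ≡ 0
∑-zero zero    eq = refl
∑-zero (suc m) eq = cong₂ _+_ (eq 0 (s≤s z≤n)) (∑-zero m (λ k k<m → eq (suc k) (s≤s k<m)))

∑-last : ∀ m f → ∑ (suc m) f ≡ ∑ m f + f m
∑-last zero    f = +-comm (f 0) 0
∑-last (suc m) f = trans (cong (f 0 +_) (∑-last m (f ∘ suc))) (sym (+-assoc (f 0) _ _))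

∑-+ : ∀ m f g → ∑ m (λ k → f k + g k) ≡ ∑ m f + ∑ m g
∑-+ zero    f g = refl
∑-+ (suc m) f g = trans (cong (f 0 + g 0 +_) (∑-+ m (f ∘ suc) (g ∘ suc))) (interchange (f 0) (g 0) _ _)

∑-comm : ∀ m p (g : ℕ → ℕ → ℕ) → ∑ m (λ b → ∑ p (g b)) ≡ ∑ p (λ c → ∑ m (λ b → g b c))
∑-comm zero    p g = sym (∑-zero p (λ _ _ → refl))
∑-comm (suc m) p g = trans (cong (∑ p (g 0) +_) (∑-comm m p (g ∘ suc))) (sym (∑-+ p (g 0) _))

∑-reverse : ∀ m f → ∑ m (λ c → f (m ∸ suc c)) ≡ ∑ m f
∑-reverse zero    f = refl
∑-reverse (suc m) f = trans (cong (f m +_) (∑-reverse m f)) (trans (+-comm (f m) _) (sym (∑-last m f)))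

∑-split : ∀ m p f → ∑ (m + p) f ≡ ∑ m f + ∑ p (λ k → f (m + k))
∑-split zero    p f = refl
∑-split (suc m) p f = trans (cong (f 0 +_) (∑-split m p (f ∘ suc))) (sym (+-assoc (f 0) _ _))

∑-indicator< : k ≤ m → ∑ m (λ b → if b <ᵇ k then 1 else 0) ≡ k
∑-indicator< {zero}  {m}     _         = ∑-zero m (λ _ _ → refl)
∑-indicator< {suc k} {suc m} (s≤s k≤m) = cong suc (∑-indicator< k≤m)

∑-countBelow : ∀ p → (∀ c → f c ≤ m) → ∑ m (λ b → ∑ p (λ c → if b <ᵇ f c then 1 else 0)) ≡ ∑ p f
∑-countBelow {f} {m} p f≤m =
  trans (∑-comm m p _) (∑-cong p (λ c _ → ∑-indicator< (f≤m c)))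

Move-InT : ∀ n {x u v} → Move x u v → InT n v → InT n u
Move-InT n (mr {a} {b} {c}) = ≤-trans (n≤1+n (a + b + c))
Move-InT n (mg {a} {b} {c}) = ≤-trans (+-monoˡ-≤ c (+-monoʳ-≤ a (n≤1+n b)))
Move-InT n (my {a} {b} {c}) = ≤-trans (+-monoʳ-≤ (a + b) (n≤1+n c))
Move-InT n (mb {a} {b} {c}) = subst (_≤ n ∸ 2) (cong (_+ c) (+-suc a b))
Move-InT n (mo {a} {b} {c}) = subst (_≤ n ∸ 2) (+-suc (a + b) c)
Move-InT n (ms {a} {b} {c}) = subst (_≤ n ∸ 2) (trans (cong (_+ c) (+-suc a b)) (sym (+-suc (a + b) c)))

module Correspondence (m : ℕ) (S : ColorSet) (green∈S : green ∈S S) where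

  n N : ℕ
  n = suc (suc m)
  N = suc m

  -- (a , b , c) ∈ T_n iff b < columnSize a c.  The array cell (a + 1 , j) sits over the
  -- column (a , columnSize a j), and columnSize a is an involution on 0 … N - a.
  columnSize : ℕ → ℕ → ℕ
  columnSize a c = N ∸ (a + c)

  InT⇒<columnSize : InT n (a , b , c) → b < columnSize a c
  InT⇒<columnSize {a} {b} {c} inT = +<⇒<∸ (s≤s (subst (_≤ m) (+-shuffle a b c) inT))

  <columnSize⇒InT : b < columnSize a c → InT n (a , b , c)
  <columnSize⇒InT {b} {a} {c} lt = subst (_≤ m) (sym (+-shuffle a b c)) (≤-pred (<∸⇒+< lt))

  columnSize-involutive : ∀ a k → a + k ≤ N → columnSize a (columnSize a k) ≡ k
  columnSize-involutive a k = ∸-+-complement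

  columnSize-sucʳ : ∀ a k → columnSize a (suc k) ≡ columnSize (suc a) k
  columnSize-sucʳ a k = cong (N ∸_) (+-suc a k)

  columnSize-sucˡ : ∀ a k → suc (a + k) ≤ N → columnSize a k ≡ suc (columnSize (suc a) k)
  columnSize-sucˡ a k = +-∸-assoc 1

  columnSize≤suc : ∀ a c → columnSize a c ≤ suc (columnSize (suc a) c)
  columnSize≤suc a c = ∸≤suc∸suc N (a + c)

  columnSize≡suc⇒< : ∀ a c → columnSize a c ≡ suc j → suc (a + c) ≤ N
  columnSize≡suc⇒< a c eq = m∸n≢0⇒n<m (λ e → 0≢1+n (trans (sym e) eq))

  columnSize-sucˡ-≡suc : ∀ a c → columnSize (suc a) c ≡ suc j → columnSize a c ≡ suc (suc j)
  columnSize-sucˡ-≡suc a c eq = trans (columnSize-sucˡ a c (<⇒≤ (columnSize≡suc⇒< (suc a) c eq))) (cong suc eq)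

  +-columnSize-≤ : ∀ a c → a + c ≤ N → a + columnSize a c ≤ N
  +-columnSize-≤ a c a+c≤N = ≤-trans (+-monoˡ-≤ _ (m≤m+n a c)) (≤-reflexive (m+[n∸m]≡n a+c≤N))

  emptyOrNonempty : ∀ a c → columnSize a c ≡ 0 ⊎ ∃[ j ] columnSize a c ≡ suc j
  emptyOrNonempty a c with columnSize a c
  ... | zero  = inj₁ refl
  ... | suc j = inj₂ (j , refl)

  nonemptyDom : ∀ a c → columnSize a c ≡ suc j → Dom n (suc a) (suc j)
  nonemptyDom a c eq = s≤s z≤n , s≤s (subst (λ t → a + t ≤ N) eq (+-columnSize-≤ a c (<⇒≤ (columnSize≡suc⇒< a c eq))))

  module _ (I : Ideal n S) where

    ideal-downward : ∀ {x} → x ∈S S → Move x u v → proj₁ I v ≡ true → proj₁ I u ≡ true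
    ideal-downward x∈S mv Iv = proj₂ (proj₂ I) _ _ ((_ , x∈S , Move-InT n mv inT , inT , mv) ◅ ε) Iv
      where inT = proj₁ (proj₂ I) _ Iv

    height : ℕ → ℕ → ℕ
    height a c = leadingTrues (λ b → proj₁ I (a , b , c)) (columnSize a c)

    height≤columnSize : ∀ a c → height a c ≤ columnSize a c
    height≤columnSize a c = leadingTrues-≤ _ (columnSize a c)

    height-sound : b < height a c → proj₁ I (a , b , c) ≡ true
    height-sound {a = a} {c} = leadingTrues-sound _ (columnSize a c)

    height-complete : proj₁ I (a , b , c) ≡ true → b < height a c
    height-complete {a} {b} {c} Ib = leadingTrues-complete _ (columnSize a c)
      (λ _ → ideal-downward green∈S mg) (InT⇒<columnSize {a} {b} {c} (proj₁ (proj₂ I) _ Ib)) Ib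

    <ᵇheight≡ : (b <ᵇ height a c) ≡ proj₁ I (a , b , c)
    <ᵇheight≡ = ⇔→≡ (mk⇔ (height-sound ∘ <ᵇ≡true⇒<) (<⇒<ᵇ≡true ∘ height-complete))

    height-≤ : ∀ δ {x a c a′ c′} → x ∈S S → (∀ b → Move x (a , b , c) (a′ , δ + b , c′)) →
               height a′ c′ ≤ δ + height a c
    height-≤ δ x∈S mv = shifted-<⇒≤ δ _ _ (λ b lt → height-complete (ideal-downward x∈S (mv b) (height-sound lt)))

    arrayOf : Array
    arrayOf zero    j = 0
    arrayOf (suc a) j = suc a + height a (columnSize a j)

    arrayOf-bounds : ∀ i j → Dom n i j → i ≤ arrayOf i j × arrayOf i j ≤ i + j
    arrayOf-bounds (suc a) j (_ , s≤s a+j≤N) = m≤m+n (suc a) _ , +-monoʳ-≤ (suc a)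
      (subst (height a (columnSize a j) ≤_) (columnSize-involutive a j a+j≤N) (height≤columnSize a _))

    arrayOf-orange : orange ∈S S → ∀ i j → Dom n i j → Dom n (suc i) j → arrayOf i j < arrayOf (suc i) j
    arrayOf-orange o (suc a) j _ (_ , s≤s a+j<N) = s≤s (+-monoʳ-≤ (suc a) (begin
      height a (columnSize a j)              ≡⟨ cong (height a) (columnSize-sucˡ a j a+j<N) ⟩
      height a (suc (columnSize (suc a) j))  ≤⟨ height-≤ 0 o (λ _ → mo {a} {c = columnSize (suc a) j}) ⟩
      height (suc a) (columnSize (suc a) j)  ∎))
      where open ≤-Reasoning

    arrayOf-red : red ∈S S → ∀ i j → Dom n (suc i) j → Dom n i (suc j) → arrayOf (suc i) j ≤ arrayOf i (suc j) + 1
    arrayOf-red r zero    j _ (() , _)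
    arrayOf-red r (suc a) j _ _ = begin
      suc (suc a + height (suc a) column)            ≤⟨ s≤s (+-monoʳ-≤ (suc a) (height-≤ 0 r (λ _ → mr {a} {c = column}))) ⟩
      suc (suc a + height a column)                  ≡⟨ cong (λ t → suc (suc a + height a t)) (columnSize-sucʳ a j) ⟨
      suc (suc a + height a (columnSize a (suc j)))  ≡⟨ +-comm 1 _ ⟩
      suc a + height a (columnSize a (suc j)) + 1    ∎
      where
      open ≤-Reasoning
      column = columnSize (suc a) j

    arrayOf-yellow : yellow ∈S S → ∀ i j → Dom n i j → Dom n i (suc j) → arrayOf i j ≤ arrayOf i (suc j)
    arrayOf-yellow yw (suc a) j _ (_ , s≤s a+sj≤N) = +-monoʳ-≤ (suc a) (begin
      height a (columnSize a j)        ≡⟨ cong (height a) (columnSize-sucˡ a j (subst (_≤ N) (+-suc a j) a+sj≤N)) ⟩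
      height a (suc column)            ≤⟨ height-≤ 0 yw (λ _ → my {a} {c = column}) ⟩
      height a column                  ≡⟨ cong (height a) (columnSize-sucʳ a j) ⟨
      height a (columnSize a (suc j))  ∎)
      where
      open ≤-Reasoning
      column = columnSize (suc a) j

    arrayOf-blue : blue ∈S S → ∀ i j → Dom n i (suc j) → Dom n (suc i) j → arrayOf i (suc j) ≤ arrayOf (suc i) j
    arrayOf-blue bl (suc a) j _ _ = begin
      suc a + height a (columnSize a (suc j))  ≡⟨ cong (λ t → suc a + height a t) (columnSize-sucʳ a j) ⟩
      suc a + height a column                  ≤⟨ +-monoʳ-≤ (suc a) (height-≤ 1 bl (λ _ → mb {a} {c = column})) ⟩
      suc a + suc (height (suc a) column)      ≡⟨ +-suc (suc a) _ ⟩
      suc (suc a) + height (suc a) column      ∎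
      where
      open ≤-Reasoning
      column = columnSize (suc a) j

    arrayOf-silver : silver ∈S S → ∀ i j → Dom n i (suc j) → Dom n i j → arrayOf i (suc j) ≤ arrayOf i j + 1
    arrayOf-silver sv (suc a) j (_ , s≤s a+sj≤N) _ = begin
      suc a + height a (columnSize a (suc j))  ≡⟨ cong (λ t → suc a + height a t) (columnSize-sucʳ a j) ⟩
      suc a + height a column                  ≤⟨ +-monoʳ-≤ (suc a) (height-≤ 1 sv (λ _ → ms {a} {c = column})) ⟩
      suc a + suc (height a (suc column))      ≡⟨ cong (λ t → suc a + suc (height a t)) column-pred ⟨
      suc a + suc (height a (columnSize a j))  ≡⟨ trans (+-suc (suc a) _) (+-comm 1 _) ⟩
      suc a + height a (columnSize a j) + 1    ∎
      where
      open ≤-Reasoning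
      column = columnSize (suc a) j
      column-pred : columnSize a j ≡ suc column
      column-pred = columnSize-sucˡ a j (subst (_≤ N) (+-suc a j) a+sj≤N)

    arrayOf∈Y : IsY n S arrayOf
    arrayOf∈Y = arrayOf-bounds , arrayOf-orange , arrayOf-red , arrayOf-yellow , arrayOf-blue , arrayOf-silver

  arrayOfY : Ideal n S → Y n S
  arrayOfY I = arrayOf I , arrayOf∈Y I

  -- Capping by columnSize makes arrayHeight independent of entries outside the array: an
  -- empty column with a > N points at the cell (a + 1 , 0), which is not in it.
  arrayHeight : Array → ℕ → ℕ → ℕ
  arrayHeight x a c = columnSize a c ⊓ (x (suc a) (columnSize a c) ∸ suc a)

  arrayHeight-at : ∀ x a c → columnSize a c ≡ k → arrayHeight x a c ≡ k ⊓ (x (suc a) k ∸ suc a)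
  arrayHeight-at x a c eq = cong (λ t → t ⊓ (x (suc a) t ∸ suc a)) eq

  arrayHeight-empty : ∀ x a c → columnSize a c ≡ 0 → arrayHeight x a c ≡ 0
  arrayHeight-empty x a c = arrayHeight-at x a c

  arrayHeight≤columnSize : ∀ x a c → arrayHeight x a c ≤ columnSize a c
  arrayHeight≤columnSize x a c = m⊓n≤m _ _

  arrayHeight≤1 : ∀ x a c → columnSize (suc a) c ≡ 0 → arrayHeight x a c ≤ 1
  arrayHeight≤1 x a c eq =
    ≤-trans (arrayHeight≤columnSize x a c) (subst (λ t → columnSize a c ≤ suc t) eq (columnSize≤suc a c))

  arrayHeight-cell : IsY n S x → Dom n (suc a) j → columnSize a c ≡ j → arrayHeight x a c ≡ x (suc a) j ∸ suc a
  arrayHeight-cell {x} {a} {j} {c} (bounds , _) d eq = trans (arrayHeight-at x a c eq)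
    (m≥n⇒m⊓n≡n (m≤n+o⇒m∸n≤o _ (suc a) (proj₂ (bounds (suc a) j d))))

  arrayHeight-nonempty : IsY n S x → ∀ a c → columnSize a c ≡ suc j → arrayHeight x a c ≡ x (suc a) (suc j) ∸ suc a
  arrayHeight-nonempty x∈Y a c eq = arrayHeight-cell x∈Y (nonemptyDom a c eq) eq

  arrayHeight-red : IsY n S x → red ∈S S → ∀ a c → arrayHeight x (suc a) c ≤ arrayHeight x a c
  arrayHeight-red {x} x∈Y@(_ , _ , red-ok , _) r a c with emptyOrNonempty (suc a) c
  ... | inj₁ eq       = ≤-trans (≤-reflexive (arrayHeight-empty x (suc a) c eq)) z≤n
  ... | inj₂ (j , eq) = begin
    arrayHeight x (suc a) c                ≡⟨ arrayHeight-nonempty x∈Y (suc a) c eq ⟩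
    x (suc (suc a)) (suc j) ∸ suc (suc a)  ≤⟨ ∸-monoˡ-≤ (suc (suc a)) (≤+1⇒≤suc
                                                (red-ok r (suc a) (suc j) (nonemptyDom (suc a) c eq) (nonemptyDom a c eq′))) ⟩
    x (suc a) (suc (suc j)) ∸ suc a        ≡⟨ arrayHeight-nonempty x∈Y a c eq′ ⟨
    arrayHeight x a c                      ∎
    where
    open ≤-Reasoning
    eq′ = columnSize-sucˡ-≡suc a c eq

  arrayHeight-yellow : IsY n S x → yellow ∈S S → ∀ a c → arrayHeight x a (suc c) ≤ arrayHeight x a c
  arrayHeight-yellow {x} x∈Y@(_ , _ , _ , yellow-ok , _) yw a c with emptyOrNonempty (suc a) c
  ... | inj₁ eq       = ≤-trans (≤-reflexive (arrayHeight-empty x a (suc c) (trans (columnSize-sucʳ a c) eq))) z≤n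
  ... | inj₂ (j , eq) = begin
    arrayHeight x a (suc c)          ≡⟨ arrayHeight-nonempty x∈Y a (suc c) eqQ ⟩
    x (suc a) (suc j) ∸ suc a        ≤⟨ ∸-monoˡ-≤ (suc a)
                                          (yellow-ok yw (suc a) (suc j) (nonemptyDom a (suc c) eqQ) (nonemptyDom a c eqP)) ⟩
    x (suc a) (suc (suc j)) ∸ suc a  ≡⟨ arrayHeight-nonempty x∈Y a c eqP ⟨
    arrayHeight x a c                ∎
    where
    open ≤-Reasoning
    eqQ = trans (columnSize-sucʳ a c) eq
    eqP = columnSize-sucˡ-≡suc a c eq

  arrayHeight-orange : IsY n S x → orange ∈S S → ∀ a c → arrayHeight x a (suc c) ≤ arrayHeight x (suc a) c
  arrayHeight-orange {x} x∈Y@(_ , orange-ok , _) o a c with emptyOrNonempty (suc a) c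
  ... | inj₁ eq       = ≤-trans (≤-reflexive (arrayHeight-empty x a (suc c) (trans (columnSize-sucʳ a c) eq))) z≤n
  ... | inj₂ (j , eq) = begin
    arrayHeight x a (suc c)                ≡⟨ arrayHeight-nonempty x∈Y a (suc c) eqQ ⟩
    x (suc a) (suc j) ∸ suc a              ≤⟨ ∸-monoˡ-≤ (suc (suc a))
                                                (orange-ok o (suc a) (suc j) (nonemptyDom a (suc c) eqQ) (nonemptyDom (suc a) c eq)) ⟩
    x (suc (suc a)) (suc j) ∸ suc (suc a)  ≡⟨ arrayHeight-nonempty x∈Y (suc a) c eq ⟨
    arrayHeight x (suc a) c                ∎
    where
    open ≤-Reasoning
    eqQ = trans (columnSize-sucʳ a c) eq

  arrayHeight-blue : IsY n S x → blue ∈S S → ∀ a c → arrayHeight x a c ≤ 1 + arrayHeight x (suc a) c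
  arrayHeight-blue {x} x∈Y@(_ , _ , _ , _ , blue-ok , _) bl a c with emptyOrNonempty (suc a) c
  ... | inj₁ eq       = ≤-trans (arrayHeight≤1 x a c eq) (s≤s z≤n)
  ... | inj₂ (j , eq) = begin
    arrayHeight x a c                            ≡⟨ arrayHeight-nonempty x∈Y a c eqQ ⟩
    x (suc a) (suc (suc j)) ∸ suc a              ≤⟨ ∸-monoˡ-≤ (suc a)
                                                      (blue-ok bl (suc a) (suc j) (nonemptyDom a c eqQ) (nonemptyDom (suc a) c eq)) ⟩
    x (suc (suc a)) (suc j) ∸ suc a              ≤⟨ ∸≤suc∸suc (x (suc (suc a)) (suc j)) (suc a) ⟩
    suc (x (suc (suc a)) (suc j) ∸ suc (suc a))  ≡⟨ cong suc (arrayHeight-nonempty x∈Y (suc a) c eq) ⟨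
    suc (arrayHeight x (suc a) c)                ∎
    where
    open ≤-Reasoning
    eqQ = columnSize-sucˡ-≡suc a c eq

  arrayHeight-silver : IsY n S x → silver ∈S S → ∀ a c → arrayHeight x a c ≤ 1 + arrayHeight x a (suc c)
  arrayHeight-silver {x} x∈Y@(_ , _ , _ , _ , _ , silver-ok) sv a c with emptyOrNonempty (suc a) c
  ... | inj₁ eq       = ≤-trans (arrayHeight≤1 x a c eq) (s≤s z≤n)
  ... | inj₂ (j , eq) = begin
    arrayHeight x a c                ≡⟨ arrayHeight-nonempty x∈Y a c eqQ ⟩
    x (suc a) (suc (suc j)) ∸ suc a  ≤⟨ ∸-monoˡ-≤ (suc a) (≤+1⇒≤suc
                                          (silver-ok sv (suc a) (suc j) (nonemptyDom a c eqQ) (nonemptyDom a (suc c) eqP))) ⟩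
    suc (x (suc a) (suc j)) ∸ suc a  ≤⟨ suc∸≤suc∸ _ (suc a) ⟩
    suc (x (suc a) (suc j) ∸ suc a)  ≡⟨ cong suc (arrayHeight-nonempty x∈Y a (suc c) eqP) ⟨
    suc (arrayHeight x a (suc c))    ∎
    where
    open ≤-Reasoning
    eqQ = columnSize-sucˡ-≡suc a c eq
    eqP = trans (columnSize-sucʳ a c) eq

  heightIdeal : Array → Triple → Bool
  heightIdeal x (a , b , c) = b <ᵇ arrayHeight x a c

  heightIdeal-step : IsY n S x → Step n S u v → heightIdeal x v ≡ true → heightIdeal x u ≡ true
  heightIdeal-step x∈Y (red    , r  , _ , _ , mr {a} {c = c}) = shifted-<ᵇ 0 (arrayHeight-red x∈Y r a c)
  heightIdeal-step {x} x∈Y (green  , _  , _ , _ , mg {a} {c = c}) = shifted-<ᵇ 1 (n≤1+n (arrayHeight x a c))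
  heightIdeal-step x∈Y (yellow , yw , _ , _ , my {a} {c = c}) = shifted-<ᵇ 0 (arrayHeight-yellow x∈Y yw a c)
  heightIdeal-step x∈Y (blue   , bl , _ , _ , mb {a} {c = c}) = shifted-<ᵇ 1 (arrayHeight-blue x∈Y bl a c)
  heightIdeal-step x∈Y (orange , o  , _ , _ , mo {a} {c = c}) = shifted-<ᵇ 0 (arrayHeight-orange x∈Y o a c)
  heightIdeal-step x∈Y (silver , sv , _ , _ , ms {a} {c = c}) = shifted-<ᵇ 1 (arrayHeight-silver x∈Y sv a c)

  idealOf : Y n S → Ideal n S
  idealOf (x , x∈Y) = heightIdeal x , inT , downward
    where
    inT : ∀ t → heightIdeal x t ≡ true → InT n t
    inT (a , b , c) e = <columnSize⇒InT {b} {a} {c} (<-≤-trans (<ᵇ≡true⇒< e) (arrayHeight≤columnSize x a c))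
    downward : ∀ u v → u ≼[ n , S ] v → heightIdeal x v ≡ true → heightIdeal x u ≡ true
    downward _ _ = fold (λ u v → heightIdeal x v ≡ true → heightIdeal x u ≡ true)
                        (λ step later → heightIdeal-step x∈Y step ∘ later) id

  height-idealOf : ∀ (y : Y n S) a c → height (idealOf y) a c ≡ arrayHeight (proj₁ y) a c
  height-idealOf (x , _) a c = leadingTrues-<ᵇ (arrayHeight≤columnSize x a c)

  arrayOf-idealOf : ∀ (y : Y n S) i j → Dom n i j → arrayOf (idealOf y) i j ≡ proj₁ y i j
  arrayOf-idealOf y@(x , x∈Y@(bounds , _)) (suc a) j d@(_ , s≤s a+j≤N) = begin
    suc a + height (idealOf y) a (columnSize a j)  ≡⟨ cong (suc a +_) (height-idealOf y a _) ⟩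
    suc a + arrayHeight x a (columnSize a j)       ≡⟨ cong (suc a +_) (arrayHeight-cell x∈Y d (columnSize-involutive a j a+j≤N)) ⟩
    suc a + (x (suc a) j ∸ suc a)                  ≡⟨ m+[n∸m]≡n (proj₁ (bounds (suc a) j d)) ⟩
    x (suc a) j                                    ∎
    where open ≡-Reasoning

  arrayHeight-arrayOf : ∀ I a c → arrayHeight (arrayOf I) a c ≡ height I a c
  arrayHeight-arrayOf I a c with a + c ≤? N
  ... | yes a+c≤N = begin
    columnSize a c ⊓ (suc a + height I a (columnSize a (columnSize a c)) ∸ suc a)
      ≡⟨ cong (columnSize a c ⊓_) (m+n∸m≡n (suc a) _) ⟩
    columnSize a c ⊓ height I a (columnSize a (columnSize a c))
      ≡⟨ cong (λ t → columnSize a c ⊓ height I a t) (columnSize-involutive a c a+c≤N) ⟩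
    columnSize a c ⊓ height I a c
      ≡⟨ m≥n⇒m⊓n≡n (height≤columnSize I a c) ⟩
    height I a c
      ∎
    where open ≡-Reasoning
  ... | no a+c≰N = trans (arrayHeight-empty (arrayOf I) a c empty) (sym (cong (leadingTrues _) empty))
    where
    empty : columnSize a c ≡ 0
    empty = m≤n⇒m∸n≡0 (<⇒≤ (≰⇒> a+c≰N))

  idealOf-arrayOf : ∀ I t → heightIdeal (arrayOf I) t ≡ proj₁ I t
  idealOf-arrayOf I (a , b , c) = trans (cong (b <ᵇ_) (arrayHeight-arrayOf I a c)) (<ᵇheight≡ I)

  arrayHeight-cong : ∀ {x z} → (∀ i j → Dom n i j → x i j ≡ z i j) → ∀ a c → arrayHeight x a c ≡ arrayHeight z a c
  arrayHeight-cong {x} {z} x≈z a c with emptyOrNonempty a c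
  ... | inj₁ eq       = trans (arrayHeight-empty x a c eq) (sym (arrayHeight-empty z a c eq))
  ... | inj₂ (j , eq) = trans (arrayHeight-at x a c eq) (trans
    (cong (λ t → suc j ⊓ (t ∸ suc a)) (x≈z (suc a) (suc j) (nonemptyDom a c eq))) (sym (arrayHeight-at z a c eq)))

  idealOf-cong : ∀ {y z : Y n S} → (∀ i j → Dom n i j → proj₁ y i j ≡ proj₁ z i j) →
                 ∀ t → proj₁ (idealOf y) t ≡ proj₁ (idealOf z) t
  idealOf-cong {_ , _} {_ , _} y≈z (a , b , c) = cong (b <ᵇ_) (arrayHeight-cong y≈z a c)

  arrayOf-cong : ∀ {I J : Ideal n S} → (∀ t → proj₁ I t ≡ proj₁ J t) →
                 ∀ i j → Dom n i j → arrayOf I i j ≡ arrayOf J i j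
  arrayOf-cong I≈J (suc a) j _ = cong (suc a +_) (leadingTrues-cong (columnSize a (columnSize a j)) (λ b → I≈J (a , b , columnSize a j)))

  inverse : Inverse (YSetoid n S) (JSetoid n S)
  inverse = record
    { to        = idealOf
    ; from      = arrayOfY
    ; to-cong   = λ {y} {z} → idealOf-cong {y} {z}
    ; from-cong = λ {I} {J} → arrayOf-cong {I} {J}
    ; inverse   = (λ {I} {y} y≈ t → trans (idealOf-cong {y} {arrayOfY I} y≈ t) (idealOf-arrayOf I t))
                , (λ {y} {I} I≈ i j d → trans (arrayOf-cong {I} {idealOf y} I≈ i j d) (arrayOf-idealOf y i j d))
    }

  arrayHeight-lastRow : ∀ x c → arrayHeight x N c ≡ 0
  arrayHeight-lastRow x c = arrayHeight-empty x N c (m≤n⇒m∸n≡0 (m≤m+n N c))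

  ∑-row : IsY n S x → ∀ a → a ≤ N → ∑ n (arrayHeight x a) ≡ ∑ (suc (N ∸ a)) (λ j → x (suc a) j ∸ suc a)
  ∑-row {x} x∈Y a a≤N = begin
    ∑ n (arrayHeight x a)
      ≡⟨ cong (λ t → ∑ (suc t) (arrayHeight x a)) (m∸n+n≡m a≤N) ⟨
    ∑ (suc (N ∸ a) + a) (arrayHeight x a)
      ≡⟨ ∑-split (suc (N ∸ a)) a (arrayHeight x a) ⟩
    ∑ (suc (N ∸ a)) (arrayHeight x a) + ∑ a (λ k → arrayHeight x a (suc (N ∸ a) + k))
      ≡⟨ cong₂ _+_ (∑-cong (suc (N ∸ a)) (λ c _ → arrayHeight-cell x∈Y (dom c) (sym (∸-+-assoc N a c))))
                   (∑-zero a (λ k _ → arrayHeight-empty x a _ (beyond k))) ⟩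
    ∑ (suc (N ∸ a)) (λ c → x (suc a) (N ∸ a ∸ c) ∸ suc a) + 0
      ≡⟨ +-identityʳ _ ⟩
    ∑ (suc (N ∸ a)) (λ c → x (suc a) (N ∸ a ∸ c) ∸ suc a)
      ≡⟨ ∑-reverse (suc (N ∸ a)) (λ j → x (suc a) j ∸ suc a) ⟩
    ∑ (suc (N ∸ a)) (λ j → x (suc a) j ∸ suc a)
      ∎
    where
    open ≡-Reasoning
    dom : ∀ c → Dom n (suc a) (N ∸ a ∸ c)
    dom c = s≤s z≤n , s≤s (≤-trans (+-monoʳ-≤ a (m∸n≤m (N ∸ a) c)) (≤-reflexive (m+[n∸m]≡n a≤N)))
    beyond : ∀ k → columnSize a (suc (N ∸ a) + k) ≡ 0
    beyond k = m≤n⇒m∸n≡0 (≤-trans (≤-reflexive (sym (m+[n∸m]≡n a≤N)))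
                                  (+-monoʳ-≤ a (≤-trans (n≤1+n _) (m≤m+n _ k))))

  weight-idealOf : ∀ y → weightJ n S (idealOf y) ≡ weightY n S y
  weight-idealOf (x , x∈Y) = begin
    weightJ n S (idealOf (x , x∈Y))
      ≡⟨ Σ<≡∑-cong n (λ a _ → Σ<≡∑-cong n (λ b _ → Σ<≡∑ n (λ c → if b <ᵇ arrayHeight x a c then 1 else 0))) ⟩
    ∑ n (λ a → ∑ n (λ b → ∑ n (λ c → if b <ᵇ arrayHeight x a c then 1 else 0)))
      ≡⟨ ∑-cong n (λ a _ → ∑-countBelow n (arrayHeight≤n a)) ⟩
    ∑ n (λ a → ∑ n (arrayHeight x a))
      ≡⟨ ∑-last N (λ a → ∑ n (arrayHeight x a)) ⟩
    ∑ N (λ a → ∑ n (arrayHeight x a)) + ∑ n (arrayHeight x N)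
      ≡⟨ cong (∑ N (λ a → ∑ n (arrayHeight x a)) +_) (∑-zero n (λ c _ → arrayHeight-lastRow x c)) ⟩
    ∑ N (λ a → ∑ n (arrayHeight x a)) + 0
      ≡⟨ +-identityʳ _ ⟩
    ∑ N (λ a → ∑ n (arrayHeight x a))
      ≡⟨ ∑-cong N (λ a a<N → ∑-row x∈Y a (<⇒≤ a<N)) ⟩
    ∑ N (λ a → ∑ (suc (N ∸ a)) (λ j → x (suc a) j ∸ suc a))
      ≡⟨ Σ<≡∑-cong N (λ a _ → Σ<≡∑ (suc (N ∸ a)) (λ j → x (suc a) j ∸ suc a)) ⟨
    weightY n S (x , x∈Y)
      ∎
    where
    open ≡-Reasoning
    arrayHeight≤n : ∀ a c → arrayHeight x a c ≤ n
    arrayHeight≤n a c = ≤-trans (arrayHeight≤columnSize x a c) (≤-trans (m∸n≤m N (a + c)) (n≤1+n N))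

proposition6 : (n : ℕ) → 2 ≤ n → (S : ColorSet) → Admissible S → green ∈S S →
    Σ (Bijection (YSetoid n S) (JSetoid n S))
      (λ φ → ∀ x → weightJ n S (Bijection.to φ x) ≡ weightY n S x)
proposition6 (suc zero)    (s≤s ()) _ _ _
proposition6 (suc (suc m)) _ S _ green∈S = Inverse⇒Bijection inverse , weight-idealOf
  where open Correspondence m S green∈S
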